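{- Let $T_4=\{12,1\overline{2},2\overline{1}\}$. Then for every $n\ge 1$, $b_n(T_4\cup\{\overline{1}\,\overline{2}\})=b_n(T_4\cup\{\overline{2}\,\overline{1}\})=2^n$ and $b_n(T_4\cup\{21\})=2\cdot n!$.
   Context: A signed permutation of length $n$ is a word $\alpha=\alpha_1\cdots\alpha_n$ in which each of the symbols $1,\dots,n$ appears exactly once, each occurrence possibly barred (written $\overline{i}$). The set of all of them is $B_n$. For a symbol $x$, $|x|$ denotes the underlying number with any bar removed. For $\tau=\tau_1\cdots\tau_k\in B_k$ and $\alpha\in B_n$, $\alpha$ contains $\tau$ if there are indices $1\le i_1<\cdots<i_k\le n$ such that (1) $|\alpha_{i_p}|>|\alpha_{i_q}|$ if and only if $|\tau_p|>|\tau_q|$ for all $p,q$, and (2) $\alpha_{i_j}$ is barred if and only if $\tau_j$ is barred for every $j$. Otherwise $\alpha$ avoids $\tau$. $B_n(T)$ is the set of $\alpha\in B_n$ avoiding every pattern in $T$, and $b_n(T)=|B_n(T)|$. -}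

module Defs where

open import Data.Nat using (ℕ; zero; suc; _+_; _*_; _<ᵇ_; _≡ᵇ_)
open import Data.Bool using (Bool; true; false; _∧_; not; if_then_else_)
open import Data.Product using (_×_; _,_; proj₁; proj₂)
open import Data.List using (List; []; _∷_; map; concatMap; length; zip; upTo; _++_)
open import Data.Bool.ListAction using (all; any)

-- A symbol (letter) of a signed permutation: (underlying number |x|, barred?).
Letter : Set
Letter = ℕ × Bool

Word : Set
Word = List Letter

∣_∣ˡ : Letter → ℕ
∣ x ∣ˡ = proj₁ x

barred : Letter → Bool
barred = proj₂

u b : ℕ → Letter
u i = i , false
b i = i , true

alphabet : ℕ → List Letter
alphabet n = concatMap (λ i → (suc i , false) ∷ (suc i , true) ∷ []) (upTo n)

wordsOf : List Letter → ℕ → List Word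
wordsOf A zero    = [] ∷ []
wordsOf A (suc k) = concatMap (λ x → map (x ∷_) (wordsOf A k)) A

occ : ℕ → Word → ℕ
occ i []      = 0
occ i (x ∷ w) = (if ∣ x ∣ˡ ≡ᵇ i then 1 else 0) + occ i w

isSignedPerm : ℕ → Word → Bool
isSignedPerm n w = all (λ i → occ (suc i) w ≡ᵇ 1) (upTo n)

boolFilter : {A : Set} → (A → Bool) → List A → List A
boolFilter p []       = []
boolFilter p (x ∷ xs) = if p x then x ∷ boolFilter p xs else boolFilter p xs

B : ℕ → List Word
B n = boolFilter (isSignedPerm n) (wordsOf (alphabet n) n)

subseqs : ℕ → Word → List Word
subseqs zero    w       = [] ∷ []
subseqs (suc k) []      = []
subseqs (suc k) (x ∷ w) = map (x ∷_) (subseqs k w) ++ subseqs (suc k) w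

_==_ : Bool → Bool → Bool
true  == y = y
false == y = not y

isOccurrence : Word → Word → Bool
isOccurrence τ s =
  (length s ≡ᵇ length τ) ∧
  all (λ { (x , t) →
        (barred x == barred t) ∧
        all (λ { (y , v) → (∣ y ∣ˡ <ᵇ ∣ x ∣ˡ) == (∣ v ∣ˡ <ᵇ ∣ t ∣ˡ) }) (zip s τ) })
      (zip s τ)

contains : Word → Word → Bool
contains α τ = any (isOccurrence τ) (subseqs (length τ) α)

avoidsAll : List Word → Word → Bool
avoidsAll T α = all (λ τ → not (contains α τ)) T

bₙ : ℕ → List Word → ℕ
bₙ n T = length (boolFilter (avoidsAll T) (B n))

T₄ : List Word
T₄ = (u 1 ∷ u 2 ∷ []) ∷ (u 1 ∷ b 2 ∷ []) ∷ (u 2 ∷ b 1 ∷ []) ∷ []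

-- Every pattern of T₄ starts with an unbarred letter, and together they say that an unbarred
-- letter can only be followed by smaller unbarred letters. So an avoider is a run of barred
-- letters followed by a decreasing run of unbarred letters. Adding 1̄2̄ (resp. 2̄1̄) forces the
-- barred run to decrease (resp. increase), so an avoider is determined by its set of barred
-- letters: 2ⁿ avoiders. Adding 21 leaves at most one unbarred letter, placed last, which gives
-- n! + n·(n-1)! = 2·n! avoiders. As all patterns have length two, both counts follow by
-- recursion on the first letter, remembering only the unused values and the last letter.
module Submission where

open import Defs
open import Data.Nat using (ℕ; zero; suc; _+_; _*_; _^_; _!; _≤_; _<_; s≤s; _<ᵇ_; _≡ᵇ_)
open import Data.Nat.Properties
open import Data.Nat.ListAction using (sum)
open import Data.Nat.ListAction.Properties using (sum-++)
open import Data.Bool using (Bool; true; false; T; _∧_; _∨_; not; if_then_else_)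
open import Data.Bool.Properties
  using (if-float; ∨-assoc; ∧-assoc; ∧-comm; ∧-identityʳ; ∧-zeroʳ; ∧-conicalʳ; T-≡;
         ∧-commutativeMonoid; ∨-∧-booleanAlgebra)
open import Data.Bool.ListAction using (all; any)
open import Data.List using (List; []; _∷_; _++_; map; concatMap; length; upTo)
open import Data.List.Properties using (upTo-∷ʳ; map-++)
open import Data.Maybe using (Maybe; just; nothing)
open import Data.Product using (_×_; _,_; Σ-syntax)
open import Data.Empty using (⊥-elim)
open import Function using (_∘_; Equivalence)
open import Relation.Binary.PropositionalEquality
open import Algebra.Bundles using (CommutativeMonoid)
import Algebra.Properties.CommutativeSemigroup as CommutativeSemigroupProperties
open CommutativeSemigroupProperties +-commutativeSemigroup
  using () renaming (interchange to +-interchange)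
open CommutativeSemigroupProperties *-commutativeSemigroup
  using () renaming (x∙yz≈y∙xz to *-exchange)
open CommutativeSemigroupProperties (CommutativeMonoid.commutativeSemigroup ∧-commutativeMonoid)
  using () renaming (interchange to ∧-interchange; x∙yz≈y∙xz to ∧-exchange)
open import Algebra.Lattice.Properties.BooleanAlgebra ∨-∧-booleanAlgebra using (deMorgan₂)
open import Relation.Binary.Definitions using (tri<; tri≈; tri>)
open import Relation.Nullary using (yes; no)

ind : Bool → ℕ
ind b = if b then 1 else 0

<ᵇ-irrefl : ∀ n → (n <ᵇ n) ≡ false
<ᵇ-irrefl zero    = refl
<ᵇ-irrefl (suc n) = <ᵇ-irrefl n

≡ᵇ-refl : ∀ n → (n ≡ᵇ n) ≡ true
≡ᵇ-refl zero    = refl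
≡ᵇ-refl (suc n) = ≡ᵇ-refl n

<ᵇ≡true⇒< : ∀ {m n} → (m <ᵇ n) ≡ true → m < n
<ᵇ≡true⇒< {m} {n} eq = <ᵇ⇒< m n (Equivalence.from T-≡ eq)

<⇒<ᵇ≡true : ∀ {m n} → m < n → (m <ᵇ n) ≡ true
<⇒<ᵇ≡true m<n = Equivalence.to T-≡ (<⇒<ᵇ m<n)

≤⇒<ᵇ≡false : ∀ {m n} → n ≤ m → (m <ᵇ n) ≡ false
≤⇒<ᵇ≡false {m} {n} n≤m with m <ᵇ n in eq
... | false = refl
... | true  = ⊥-elim (<⇒≱ (<ᵇ≡true⇒< {m} {n} eq) n≤m)

<ᵇ-trans : ∀ {i j k} → (i <ᵇ j) ≡ true → (j <ᵇ k) ≡ true → (i <ᵇ k) ≡ true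
<ᵇ-trans {i} {j} {k} i<j j<k =
  <⇒<ᵇ≡true (<-trans (<ᵇ≡true⇒< {i} {j} i<j) (<ᵇ≡true⇒< {j} {k} j<k))

<ᵇ-flip : ∀ {m n} → m ≢ n → (n <ᵇ m) ≡ not (m <ᵇ n)
<ᵇ-flip {m} {n} m≢n with <-cmp m n
... | tri< m<n _ _ rewrite <⇒<ᵇ≡true m<n = ≤⇒<ᵇ≡false (<⇒≤ m<n)
... | tri≈ _ m≡n _ = ⊥-elim (m≢n m≡n)
... | tri> _ _ n<m rewrite ≤⇒<ᵇ≡false (<⇒≤ n<m) = <⇒<ᵇ≡true n<m

false≢true : false ≢ true
false≢true ()

≢⇒≡ᵇ≡false : ∀ {m n} → m ≢ n → (m ≡ᵇ n) ≡ false
≢⇒≡ᵇ≡false {m} {n} m≢n with m ≡ᵇ n in eq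
... | false = refl
... | true  = ⊥-elim (m≢n (≡ᵇ⇒≡ m n (Equivalence.from T-≡ eq)))

σ : ℕ → (ℕ → ℕ) → ℕ
σ zero    f = 0
σ (suc N) f = f N + σ N f

σ-cong : ∀ N {f g} → (∀ i → i < N → f i ≡ g i) → σ N f ≡ σ N g
σ-cong zero    f≗g = refl
σ-cong (suc N) f≗g = cong₂ _+_ (f≗g N ≤-refl) (σ-cong N (λ i i<N → f≗g i (m<n⇒m<1+n i<N)))

σ-zero : ∀ N {f} → (∀ i → i < N → f i ≡ 0) → σ N f ≡ 0
σ-zero zero    f≗0 = refl
σ-zero (suc N) f≗0 = cong₂ _+_ (f≗0 N ≤-refl) (σ-zero N (λ i i<N → f≗0 i (m<n⇒m<1+n i<N)))

σ-+ : ∀ N f g → σ N (λ i → f i + g i) ≡ σ N f + σ N g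
σ-+ zero    f g = refl
σ-+ (suc N) f g =
  trans (cong (f N + g N +_) (σ-+ N f g)) (+-interchange (f N) (g N) (σ N f) (σ N g))

σ-*ˡ : ∀ N c f → σ N (λ i → c * f i) ≡ c * σ N f
σ-*ˡ zero    c f = sym (*-zeroʳ c)
σ-*ˡ (suc N) c f =
  trans (cong (c * f N +_) (σ-*ˡ N c f)) (sym (*-distribˡ-+ c (f N) (σ N f)))

σ-single : ∀ N {f} m → m < N → (∀ i → i < N → i ≢ m → f i ≡ 0) → σ N f ≡ f m
σ-single (suc N) {f} m m<1+N rest with m ≟ N
... | yes refl = trans (cong (f m +_) (σ-zero N (λ i i<m → rest i (m<n⇒m<1+n i<m) (<⇒≢ i<m))))
                       (+-identityʳ (f m))
... | no m≢N   = cong₂ _+_ (rest N ≤-refl (m≢N ∘ sym))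
                           (σ-single N m (≤∧≢⇒< (≤-pred m<1+N) m≢N)
                                     (λ i i<N → rest i (m<n⇒m<1+n i<N)))

σ-ones : ∀ N → σ N (λ _ → 1) ≡ N
σ-ones zero    = refl
σ-ones (suc N) = cong suc (σ-ones N)

-- Over the elements i of a, 2 ^ (number of elements of a below i) runs through 2⁰, 2¹, …, 2^(k-1).
geometric-< : ∀ N a →
  σ N (λ i → if a i then 2 ^ σ N (λ j → ind (a j ∧ (j <ᵇ i))) else 0) + 1 ≡ 2 ^ σ N (ind ∘ a)
geometric-< zero    a = refl
geometric-< (suc N) a = begin
  (if a N then 2 ^ below (suc N) N else 0) + σ N (λ i → if a i then 2 ^ below (suc N) i else 0) + 1
    ≡⟨ cong₂ (λ e t → (if a N then 2 ^ e else 0) + t + 1) below-top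
             (σ-cong N (λ i i<N → cong (λ e → if a i then 2 ^ e else 0) (below-rest i i<N))) ⟩
  (if a N then 2 ^ c else 0) + S + 1
    ≡⟨ +-assoc (if a N then 2 ^ c else 0) S 1 ⟩
  (if a N then 2 ^ c else 0) + (S + 1)
    ≡⟨ cong ((if a N then 2 ^ c else 0) +_) (geometric-< N a) ⟩
  (if a N then 2 ^ c else 0) + 2 ^ c
    ≡⟨ doubling (a N) ⟩
  2 ^ (ind (a N) + c)
    ∎
  where
  open ≡-Reasoning
  below : ℕ → ℕ → ℕ
  below M i = σ M (λ j → ind (a j ∧ (j <ᵇ i)))
  c = σ N (ind ∘ a)
  S = σ N (λ i → if a i then 2 ^ below N i else 0)
  below-top : below (suc N) N ≡ c
  below-top = trans (cong₂ (λ b t → ind (a N ∧ b) + t) (<ᵇ-irrefl N) (σ-cong N all-below))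
                    (cong (λ b → ind b + c) (∧-zeroʳ (a N)))
    where
    all-below : ∀ j → j < N → ind (a j ∧ (j <ᵇ N)) ≡ ind (a j)
    all-below j j<N = cong ind (trans (cong (a j ∧_) (<⇒<ᵇ≡true j<N)) (∧-identityʳ (a j)))
  below-rest : ∀ i → i < N → below (suc N) i ≡ below N i
  below-rest i i<N =
    cong (λ b → ind b + below N i) (trans (cong (a N ∧_) (≤⇒<ᵇ≡false (<⇒≤ i<N))) (∧-zeroʳ (a N)))
  doubling : ∀ b → (if b then 2 ^ c else 0) + 2 ^ c ≡ 2 ^ (ind b + c)
  doubling true  = cong (2 ^ c +_) (sym (+-identityʳ (2 ^ c)))
  doubling false = refl

geometric-> : ∀ N a →
  σ N (λ i → if a i then 2 ^ σ N (λ j → ind (a j ∧ (i <ᵇ j))) else 0) + 1 ≡ 2 ^ σ N (ind ∘ a)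
geometric-> zero    a = refl
geometric-> (suc N) a = begin
  (if a N then 2 ^ above (suc N) N else 0) + σ N (λ i → if a i then 2 ^ above (suc N) i else 0) + 1
    ≡⟨ cong₂ (λ e t → (if a N then 2 ^ e else 0) + t + 1) above-top
             (σ-cong N (λ i i<N → cong (λ e → if a i then 2 ^ e else 0) (above-rest i i<N))) ⟩
  ind (a N) + σ N (λ i → if a i then 2 ^ (ind (a N) + above N i) else 0) + 1
    ≡⟨ halving (a N) ⟩
  2 ^ (ind (a N) + σ N (ind ∘ a))
    ∎
  where
  open ≡-Reasoning
  above : ℕ → ℕ → ℕ
  above M i = σ M (λ j → ind (a j ∧ (i <ᵇ j)))
  S = σ N (λ i → if a i then 2 ^ above N i else 0)
  above-top : above (suc N) N ≡ 0
  above-top = cong₂ _+_ (cong ind (trans (cong (a N ∧_) (<ᵇ-irrefl N)) (∧-zeroʳ (a N))))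
                        (σ-zero N none-above)
    where
    none-above : ∀ j → j < N → ind (a j ∧ (N <ᵇ j)) ≡ 0
    none-above j j<N = cong ind (trans (cong (a j ∧_) (≤⇒<ᵇ≡false (<⇒≤ j<N))) (∧-zeroʳ (a j)))
  above-rest : ∀ i → i < N → above (suc N) i ≡ ind (a N) + above N i
  above-rest i i<N =
    cong (λ b → ind b + above N i) (trans (cong (a N ∧_) (<⇒<ᵇ≡true i<N)) (∧-identityʳ (a N)))
  halving : ∀ b → ind b + σ N (λ i → if a i then 2 ^ (ind b + above N i) else 0) + 1
                  ≡ 2 ^ (ind b + σ N (ind ∘ a))
  halving false = geometric-> N a
  halving true  = begin
    suc (σ N (λ i → if a i then 2 * 2 ^ above N i else 0) + 1)
      ≡⟨ cong (λ t → suc (t + 1))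
              (trans (σ-cong N (λ i _ → sym (if-float (2 *_) (a i)))) (σ-*ˡ N 2 _)) ⟩
    suc (2 * S + 1)
      ≡⟨ sym (+-suc (2 * S) 1) ⟩
    2 * S + 2 * 1
      ≡⟨ sym (*-distribˡ-+ 2 S 1) ⟩
    2 * (S + 1)
      ≡⟨ cong (2 *_) (geometric-> N a) ⟩
    2 ^ suc (σ N (ind ∘ a))
      ∎

allB : ℕ → (ℕ → Bool) → Bool
allB zero    f = true
allB (suc N) f = f N ∧ allB N f

allB-cong : ∀ N {f g} → (∀ i → i < N → f i ≡ g i) → allB N f ≡ allB N g
allB-cong zero    f≗g = refl
allB-cong (suc N) f≗g =
  cong₂ _∧_ (f≗g N ≤-refl) (allB-cong N (λ i i<N → f≗g i (m<n⇒m<1+n i<N)))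

allB-elim : ∀ N {f} i → i < N → allB N f ≡ true → f i ≡ true
allB-elim (suc N) {f} i i<1+N holds with f N in fN | i ≟ N
... | true  | yes refl = fN
... | true  | no i≢N   = allB-elim N i (≤∧≢⇒< (≤-pred i<1+N) i≢N) holds
allB-elim (suc N) i i<1+N () | false | _

all-++ : ∀ {A : Set} (f : A → Bool) xs ys → all f (xs ++ ys) ≡ all f xs ∧ all f ys
all-++ f []       ys = refl
all-++ f (x ∷ xs) ys =
  trans (cong (f x ∧_) (all-++ f xs ys)) (sym (∧-assoc (f x) (all f xs) (all f ys)))

all-upTo : ∀ N f → all f (upTo N) ≡ allB N f
all-upTo zero    f = refl
all-upTo (suc N) f = begin
  all f (upTo (suc N))           ≡⟨ cong (all f) (sym (upTo-∷ʳ N)) ⟩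
  all f (upTo N ++ N ∷ [])       ≡⟨ all-++ f (upTo N) (N ∷ []) ⟩
  all f (upTo N) ∧ (f N ∧ true)  ≡⟨ cong₂ _∧_ (all-upTo N f) (∧-identityʳ (f N)) ⟩
  allB N f ∧ f N                 ≡⟨ ∧-comm (allB N f) (f N) ⟩
  allB (suc N) f                 ∎
  where open ≡-Reasoning

-- A finite set is a predicate on indices; index i stands for the letter value suc i.
size : ℕ → (ℕ → Bool) → ℕ
size N s = σ N (ind ∘ s)

remove : (ℕ → Bool) → ℕ → (ℕ → Bool)
remove s i j = if i ≡ᵇ j then false else s j

remove-≡ : ∀ s i → remove s i i ≡ false
remove-≡ s i rewrite ≡ᵇ-refl i = refl

remove-≢ : ∀ s {i j} → i ≢ j → remove s i j ≡ s j
remove-≢ s i≢j rewrite ≢⇒≡ᵇ≡false i≢j = refl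

σ-if : ∀ N s C → σ N (λ i → if s i then C else 0) ≡ size N s * C
σ-if zero    s C = refl
σ-if (suc N) s C with s N
... | true  = cong (C +_) (σ-if N s C)
... | false = σ-if N s C

size-remove : ∀ N s i → i < N → s i ≡ true → size N s ≡ suc (size N (remove s i))
size-remove (suc N) s i i<1+N i∈s with i ≟ N
... | yes refl = begin
  ind (s i) + size i s
    ≡⟨ cong₂ (λ b n → ind b + n) i∈s (σ-cong i rest) ⟩
  suc (size i (remove s i))
    ≡⟨ cong (λ b → suc (ind b + size i (remove s i))) (sym (remove-≡ s i)) ⟩
  suc (ind (remove s i i) + size i (remove s i))
    ∎
  where
  open ≡-Reasoning
  rest : ∀ j → j < i → ind (s j) ≡ ind (remove s i j)
  rest j j<i = cong ind (sym (remove-≢ s (<⇒≢ j<i ∘ sym)))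
... | no i≢N = begin
  ind (s N) + size N s
    ≡⟨ cong (ind (s N) +_) (size-remove N s i (≤∧≢⇒< (≤-pred i<1+N) i≢N) i∈s) ⟩
  ind (s N) + suc (size N (remove s i))
    ≡⟨ +-suc (ind (s N)) (size N (remove s i)) ⟩
  suc (ind (s N) + size N (remove s i))
    ≡⟨ cong (λ b → suc (ind b + size N (remove s i))) (sym (remove-≢ s i≢N)) ⟩
  suc (ind (remove s i N) + size N (remove s i))
    ∎
  where open ≡-Reasoning

size-remove-suc : ∀ N s i {k} → i < N → s i ≡ true → size N s ≡ suc k → size N (remove s i) ≡ k
size-remove-suc N s i i<N i∈s size≡1+k =
  suc-injective (trans (sym (size-remove N s i i<N i∈s)) size≡1+k)

size≡0⇒∉ : ∀ N s → size N s ≡ 0 → ∀ i → i < N → s i ≡ false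
size≡0⇒∉ (suc N) s size≡0 i i<1+N with s N in sN | i ≟ N
... | false | yes refl = sN
... | false | no i≢N   = size≡0⇒∉ N s size≡0 i (≤∧≢⇒< (≤-pred i<1+N) i≢N)

maximum : ∀ N s {k} → size N s ≡ suc k →
          Σ[ m ∈ ℕ ] m < N × s m ≡ true × (∀ i → i < N → s i ≡ true → i ≤ m)
maximum (suc N) s size≡1+k with s N in sN
... | true  = N , ≤-refl , sN , λ i i<1+N _ → ≤-pred i<1+N
... | false with maximum N s size≡1+k
...   | m , m<N , m∈s , m-max = m , m<n⇒m<1+n m<N , m∈s , below
  where
  below : ∀ i → i < suc N → s i ≡ true → i ≤ m
  below i i<1+N i∈s with i ≟ N
  ... | yes refl = ⊥-elim (false≢true (trans (sym sN) i∈s))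
  ... | no i≢N   = m-max i (≤∧≢⇒< (≤-pred i<1+N) i≢N) i∈s

isArrangement : ℕ → (ℕ → Bool) → Word → Bool
isArrangement N s w = allB N (λ i → occ (suc i) w ≡ᵇ ind (s i))

isSignedPerm≡isArrangement : ∀ n w → isSignedPerm n w ≡ isArrangement n (λ _ → true) w
isSignedPerm≡isArrangement n w = all-upTo n (λ i → occ (suc i) w ≡ᵇ 1)

occ-∷-≡ : ∀ i β w b → (occ (suc i) ((suc i , β) ∷ w) ≡ᵇ ind b) ≡ b ∧ (occ (suc i) w ≡ᵇ 0)
occ-∷-≡ i β w true  rewrite ≡ᵇ-refl i = refl
occ-∷-≡ i β w false rewrite ≡ᵇ-refl i = refl

occ-∷-≢ : ∀ {i j} β w → i ≢ j → occ (suc j) ((suc i , β) ∷ w) ≡ occ (suc j) w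
occ-∷-≢ β w i≢j rewrite ≢⇒≡ᵇ≡false i≢j = refl

isArrangement-∷ : ∀ N s i β w → i < N →
                  isArrangement N s ((suc i , β) ∷ w) ≡ s i ∧ isArrangement N (remove s i) w
isArrangement-∷ (suc N) s i β w i<1+N with i ≟ N
... | yes refl = begin
  (occ (suc i) x∷w ≡ᵇ ind (s i)) ∧ allB i (λ j → occ (suc j) x∷w ≡ᵇ ind (s j))
    ≡⟨ cong₂ _∧_ (occ-∷-≡ i β w (s i)) (allB-cong i (λ j j<i → unchanged j (<⇒≢ j<i ∘ sym))) ⟩
  (s i ∧ (occ (suc i) w ≡ᵇ 0)) ∧ allB i G
    ≡⟨ ∧-assoc (s i) _ _ ⟩
  s i ∧ ((occ (suc i) w ≡ᵇ 0) ∧ allB i G)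
    ≡⟨ cong (λ b → s i ∧ ((occ (suc i) w ≡ᵇ ind b) ∧ allB i G)) (sym (remove-≡ s i)) ⟩
  s i ∧ allB (suc i) G
    ∎
  where
  open ≡-Reasoning
  x∷w = (suc i , β) ∷ w
  G : ℕ → Bool
  G j = occ (suc j) w ≡ᵇ ind (remove s i j)
  unchanged : ∀ j → i ≢ j → (occ (suc j) x∷w ≡ᵇ ind (s j)) ≡ G j
  unchanged j i≢j = cong₂ _≡ᵇ_ (occ-∷-≢ β w i≢j) (cong ind (sym (remove-≢ s i≢j)))
... | no i≢N = begin
  (occ (suc N) x∷w ≡ᵇ ind (s N)) ∧ isArrangement N s x∷w
    ≡⟨ cong₂ _∧_ (cong₂ _≡ᵇ_ (occ-∷-≢ β w i≢N) (cong ind (sym (remove-≢ s i≢N))))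
                 (isArrangement-∷ N s i β w (≤∧≢⇒< (≤-pred i<1+N) i≢N)) ⟩
  G N ∧ (s i ∧ isArrangement N (remove s i) w)
    ≡⟨ ∧-exchange (G N) (s i) _ ⟩
  s i ∧ isArrangement (suc N) (remove s i) w
    ∎
  where
  open ≡-Reasoning
  x∷w = (suc i , β) ∷ w
  G : ℕ → Bool
  G j = occ (suc j) w ≡ᵇ ind (remove s i j)

isArrangement⇒occ≡0 : ∀ N s i w → i < N → isArrangement N (remove s i) w ≡ true →
                      occ (suc i) w ≡ 0
isArrangement⇒occ≡0 N s i w i<N arranged = ≡ᵇ⇒≡ _ 0 (Equivalence.from T-≡ i∉w)
  where
  i∉w : (occ (suc i) w ≡ᵇ 0) ≡ true
  i∉w = trans (cong (λ b → occ (suc i) w ≡ᵇ ind b) (sym (remove-≡ s i)))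
              (allB-elim N i i<N arranged)

isArrangement-[] : ∀ N s → size N s ≡ 0 → isArrangement N s [] ≡ true
isArrangement-[] zero    s _      = refl
isArrangement-[] (suc N) s size≡0 with s N
... | false = isArrangement-[] N s size≡0

boolFilter-cong : ∀ {A : Set} {P Q : A → Bool} → (∀ x → P x ≡ Q x) →
                  ∀ xs → boolFilter P xs ≡ boolFilter Q xs
boolFilter-cong P≗Q []       = refl
boolFilter-cong {P = P} {Q} P≗Q (x ∷ xs) rewrite P≗Q x with Q x
... | true  = cong (x ∷_) (boolFilter-cong P≗Q xs)
... | false = boolFilter-cong P≗Q xs

boolFilter-boolFilter : ∀ {A : Set} (P Q : A → Bool) xs →
                        boolFilter P (boolFilter Q xs) ≡ boolFilter (λ x → Q x ∧ P x) xs
boolFilter-boolFilter P Q []       = refl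
boolFilter-boolFilter P Q (x ∷ xs) with Q x
... | false = boolFilter-boolFilter P Q xs
... | true with P x
...   | true  = cong (x ∷_) (boolFilter-boolFilter P Q xs)
...   | false = boolFilter-boolFilter P Q xs

length-boolFilter-++ : ∀ {A : Set} (P : A → Bool) xs ys →
  length (boolFilter P (xs ++ ys)) ≡ length (boolFilter P xs) + length (boolFilter P ys)
length-boolFilter-++ P []       ys = refl
length-boolFilter-++ P (x ∷ xs) ys with P x
... | true  = cong suc (length-boolFilter-++ P xs ys)
... | false = length-boolFilter-++ P xs ys

length-boolFilter-false : ∀ {A : Set} (xs : List A) → length (boolFilter (λ _ → false) xs) ≡ 0
length-boolFilter-false []       = refl
length-boolFilter-false (x ∷ xs) = length-boolFilter-false xs

length-boolFilter-map-∷ : ∀ (P : Word → Bool) x ws →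
  length (boolFilter P (map (x ∷_) ws)) ≡ length (boolFilter (λ w → P (x ∷ w)) ws)
length-boolFilter-map-∷ P x []       = refl
length-boolFilter-map-∷ P x (w ∷ ws) with P (x ∷ w)
... | true  = cong suc (length-boolFilter-map-∷ P x ws)
... | false = length-boolFilter-map-∷ P x ws

length-boolFilter-extensions : ∀ (P : Word → Bool) ws A →
  length (boolFilter P (concatMap (λ x → map (x ∷_) ws) A))
    ≡ sum (map (λ x → length (boolFilter (λ w → P (x ∷ w)) ws)) A)
length-boolFilter-extensions P ws []      = refl
length-boolFilter-extensions P ws (x ∷ A) =
  trans (length-boolFilter-++ P (map (x ∷_) ws) (concatMap (λ x → map (x ∷_) ws) A))
        (cong₂ _+_ (length-boolFilter-map-∷ P x ws) (length-boolFilter-extensions P ws A))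

sum-map-concatMap : ∀ {A B : Set} (h : B → ℕ) (g : A → List B) xs →
                    sum (map h (concatMap g xs)) ≡ sum (map (λ x → sum (map h (g x))) xs)
sum-map-concatMap h g []       = refl
sum-map-concatMap h g (x ∷ xs) = begin
  sum (map h (g x ++ concatMap g xs))              ≡⟨ cong sum (map-++ h (g x) (concatMap g xs)) ⟩
  sum (map h (g x) ++ map h (concatMap g xs))      ≡⟨ sum-++ (map h (g x)) (map h (concatMap g xs)) ⟩
  sum (map h (g x)) + sum (map h (concatMap g xs)) ≡⟨ cong (sum (map h (g x)) +_) (sum-map-concatMap h g xs) ⟩
  sum (map (λ x → sum (map h (g x))) (x ∷ xs))     ∎
  where open ≡-Reasoning

sum-map-upTo : ∀ N f → sum (map f (upTo N)) ≡ σ N f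
sum-map-upTo zero    f = refl
sum-map-upTo (suc N) f = begin
  sum (map f (upTo (suc N)))         ≡⟨ cong (sum ∘ map f) (sym (upTo-∷ʳ N)) ⟩
  sum (map f (upTo N ++ N ∷ []))     ≡⟨ cong sum (map-++ f (upTo N) (N ∷ [])) ⟩
  sum (map f (upTo N) ++ f N ∷ [])   ≡⟨ sum-++ (map f (upTo N)) (f N ∷ []) ⟩
  sum (map f (upTo N)) + (f N + 0)   ≡⟨ cong₂ _+_ (sum-map-upTo N f) (+-identityʳ (f N)) ⟩
  σ N f + f N                        ≡⟨ +-comm (σ N f) (f N) ⟩
  σ (suc N) f                        ∎
  where open ≡-Reasoning

sum-map-alphabet : ∀ n (h : Letter → ℕ) →
                   sum (map h (alphabet n)) ≡ σ n (λ i → h (suc i , false) + h (suc i , true))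
sum-map-alphabet n h =
  trans (sum-map-concatMap h (λ i → (suc i , false) ∷ (suc i , true) ∷ []) (upTo n))
        (trans (sum-map-upTo n _)
               (σ-cong n (λ i _ → cong (h (suc i , false) +_) (+-identityʳ (h (suc i , true))))))

count : ℕ → ℕ → (Word → Bool) → ℕ
count n k P = length (boolFilter P (wordsOf (alphabet n) k))

count-cong : ∀ n k {P Q : Word → Bool} → (∀ w → P w ≡ Q w) → count n k P ≡ count n k Q
count-cong n k P≗Q = cong length (boolFilter-cong P≗Q (wordsOf (alphabet n) k))

count-zero : ∀ n P → count n 0 P ≡ ind (P [])
count-zero n P with P []
... | true  = refl
... | false = refl

count-suc : ∀ n k P → count n (suc k) P
  ≡ σ n (λ i → count n k (λ w → P ((suc i , false) ∷ w))
             + count n k (λ w → P ((suc i , true) ∷ w)))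
count-suc n k P = trans (length-boolFilter-extensions P (wordsOf (alphabet n) k) (alphabet n))
                        (sum-map-alphabet n (λ x → count n k (λ w → P (x ∷ w))))

count-guard : ∀ n k g P → count n k (λ w → g ∧ P w) ≡ (if g then count n k P else 0)
count-guard n k true  P = refl
count-guard n k false P = length-boolFilter-false (wordsOf (alphabet n) k)

patterns₂ : List (Letter × Letter) → List Word
patterns₂ = map (λ (a , c) → a ∷ c ∷ [])

pairAvoids : List Word → Letter → Letter → Bool
pairAvoids T x y = all (λ τ → not (isOccurrence τ (x ∷ y ∷ []))) T

all-true : ∀ {A : Set} (xs : List A) → all (λ _ → true) xs ≡ true
all-true []       = refl
all-true (x ∷ xs) = all-true xs

all-∧ : ∀ {A : Set} (f g : A → Bool) xs → all (λ x → f x ∧ g x) xs ≡ all f xs ∧ all g xs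
all-∧ f g []       = refl
all-∧ f g (x ∷ xs) =
  trans (cong ((f x ∧ g x) ∧_) (all-∧ f g xs)) (∧-interchange (f x) (g x) (all f xs) (all g xs))

not-any : ∀ {A : Set} (f : A → Bool) xs → not (any f xs) ≡ all (not ∘ f) xs
not-any f []       = refl
not-any f (x ∷ xs) = trans (deMorgan₂ (f x) (any f xs)) (cong (not (f x) ∧_) (not-any f xs))

any-++ : ∀ {A : Set} (f : A → Bool) xs ys → any f (xs ++ ys) ≡ any f xs ∨ any f ys
any-++ f []       ys = refl
any-++ f (x ∷ xs) ys =
  trans (cong (f x ∨_) (any-++ f xs ys)) (sym (∨-assoc (f x) (any f xs) (any f ys)))

any-pairs-with : ∀ (f : Word → Bool) x w →
                 any f (map (x ∷_) (subseqs 1 w)) ≡ any (λ y → f (x ∷ y ∷ [])) w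
any-pairs-with f x []       = refl
any-pairs-with f x (y ∷ w) = cong (f (x ∷ y ∷ []) ∨_) (any-pairs-with f x w)

contains₂-∷ : ∀ x w τ → length τ ≡ 2 →
  contains (x ∷ w) τ ≡ any (λ y → isOccurrence τ (x ∷ y ∷ [])) w ∨ contains w τ
contains₂-∷ x w (a ∷ c ∷ []) refl =
  trans (any-++ (isOccurrence (a ∷ c ∷ [])) (map (x ∷_) (subseqs 1 w)) (subseqs 2 w))
        (cong (_∨ contains w (a ∷ c ∷ [])) (any-pairs-with (isOccurrence (a ∷ c ∷ [])) x w))

avoidsAll-∷ : ∀ ps x w →
  avoidsAll (patterns₂ ps) (x ∷ w) ≡ all (pairAvoids (patterns₂ ps) x) w ∧ avoidsAll (patterns₂ ps) w
avoidsAll-∷ []             x w = sym (trans (∧-identityʳ _) (all-true w))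
avoidsAll-∷ ((a , c) ∷ ps) x w = begin
  not (contains (x ∷ w) τ) ∧ avoidsAll 𝒯 (x ∷ w)
    ≡⟨ cong₂ (λ b d → not b ∧ d) (contains₂-∷ x w τ refl) (avoidsAll-∷ ps x w) ⟩
  not (any isOcc w ∨ contains w τ) ∧ (all (pairAvoids 𝒯 x) w ∧ avoidsAll 𝒯 w)
    ≡⟨ cong (_∧ (all (pairAvoids 𝒯 x) w ∧ avoidsAll 𝒯 w)) (deMorgan₂ (any isOcc w) (contains w τ)) ⟩
  (not (any isOcc w) ∧ not (contains w τ)) ∧ (all (pairAvoids 𝒯 x) w ∧ avoidsAll 𝒯 w)
    ≡⟨ ∧-interchange (not (any isOcc w)) _ _ _ ⟩
  (not (any isOcc w) ∧ all (pairAvoids 𝒯 x) w) ∧ (not (contains w τ) ∧ avoidsAll 𝒯 w)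
    ≡⟨ cong (λ b → (b ∧ all (pairAvoids 𝒯 x) w) ∧ (not (contains w τ) ∧ avoidsAll 𝒯 w))
            (not-any isOcc w) ⟩
  (all (not ∘ isOcc) w ∧ all (pairAvoids 𝒯 x) w) ∧ (not (contains w τ) ∧ avoidsAll 𝒯 w)
    ≡⟨ cong (_∧ (not (contains w τ) ∧ avoidsAll 𝒯 w))
            (sym (all-∧ (not ∘ isOcc) (pairAvoids 𝒯 x) w)) ⟩
  all (pairAvoids (τ ∷ 𝒯) x) w ∧ avoidsAll (τ ∷ 𝒯) w
    ∎
  where
  open ≡-Reasoning
  τ = a ∷ c ∷ []
  𝒯 = patterns₂ ps
  isOcc : Letter → Bool
  isOcc y = isOccurrence τ (x ∷ y ∷ [])

avoidsAll-[] : ∀ ps → avoidsAll (patterns₂ ps) [] ≡ true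
avoidsAll-[] []       = refl
avoidsAll-[] (_ ∷ ps) = avoidsAll-[] ps

-- All patterns have length two and `adm` is transitive, so the constraint that a prefix puts on
-- the letters still to come is the one put by its last letter: that letter is the state of the
-- automaton (`nothing` before the first letter). Within an arrangement the values are distinct,
-- so `adm` only has to agree with `pairAvoids` on letters with distinct values.
module Automaton (n : ℕ) (ps : List (Letter × Letter)) (adm : Letter → Letter → Bool)
  (pairAvoids≡adm : ∀ x y → ∣ x ∣ˡ ≢ ∣ y ∣ˡ → pairAvoids (patterns₂ ps) x y ≡ adm x y)
  (adm-trans : ∀ x y z → adm x y ≡ true → adm y z ≡ true → adm x z ≡ true) where

  𝒯 : List Word
  𝒯 = patterns₂ ps

  allowed : Maybe Letter → Letter → Bool
  allowed nothing  y = true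
  allowed (just x) y = adm x y

  allowed-trans : ∀ c x y → allowed c x ≡ true → adm x y ≡ true → allowed c y ≡ true
  allowed-trans nothing  x y _   _   = refl
  allowed-trans (just z) x y z→x x→y = adm-trans z x y z→x x→y

  allowed-just : ∀ c x y → allowed c x ≡ true → ∣ y ∣ˡ ≢ ∣ x ∣ˡ →
                 allowed (just x) y ≡ allowed c y ∧ pairAvoids 𝒯 x y
  allowed-just c x y c→x y≢x rewrite pairAvoids≡adm x y (y≢x ∘ sym) with adm x y in x→y
  ... | false = sym (∧-zeroʳ (allowed c y))
  ... | true  rewrite allowed-trans c x y c→x x→y = refl

  all-allowed-just : ∀ c x w → allowed c x ≡ true → occ ∣ x ∣ˡ w ≡ 0 →
                     all (allowed (just x)) w ≡ all (allowed c) w ∧ all (pairAvoids 𝒯 x) w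
  all-allowed-just c x []      _   _ = refl
  all-allowed-just c x (y ∷ w) c→x x∉w with ∣ y ∣ˡ ≡ᵇ ∣ x ∣ˡ in y≡x
  ... | false rewrite allowed-just c x y c→x (λ eq → subst T y≡x (≡⇒≡ᵇ _ _ eq))
                    | all-allowed-just c x w c→x x∉w =
    ∧-interchange (allowed c y) (pairAvoids 𝒯 x y) (all (allowed c) w) (all (pairAvoids 𝒯 x) w)

  valid : (ℕ → Bool) → Maybe Letter → Word → Bool
  valid s c w = isArrangement n s w ∧ (all (allowed c) w ∧ avoidsAll 𝒯 w)

  valid-∷ : ∀ s c i β w → i < n →
            valid s c ((suc i , β) ∷ w)
              ≡ (s i ∧ allowed c (suc i , β)) ∧ valid (remove s i) (just (suc i , β)) w
  valid-∷ s c i β w i<n rewrite isArrangement-∷ n s i β w i<n | avoidsAll-∷ ps (suc i , β) w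
    with s i
  ... | false = refl
  ... | true with allowed c (suc i , β) in c→x
  ...   | false = ∧-zeroʳ (isArrangement n (remove s i) w)
  ...   | true with isArrangement n (remove s i) w in arranged
  ...     | false = refl
  ...     | true rewrite all-allowed-just c (suc i , β) w c→x (isArrangement⇒occ≡0 n s i w i<n arranged) =
    sym (∧-assoc (all (allowed c) w) (all (pairAvoids 𝒯 (suc i , β)) w) (avoidsAll 𝒯 w))

  ways : ℕ → (ℕ → Bool) → Maybe Letter → ℕ
  ways k s c = count n k (valid s c)

  branch : ℕ → (ℕ → Bool) → Maybe Letter → ℕ → Bool → ℕ
  branch k s c i β = if s i ∧ allowed c (suc i , β) then ways k (remove s i) (just (suc i , β)) else 0

  ways-suc : ∀ k s c → ways (suc k) s c ≡ σ n (λ i → branch k s c i false + branch k s c i true)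
  ways-suc k s c =
    trans (count-suc n k (valid s c))
          (σ-cong n (λ i i<n → cong₂ _+_ (first i false i<n) (first i true i<n)))
    where
    first : ∀ i β → i < n → count n k (λ w → valid s c ((suc i , β) ∷ w)) ≡ branch k s c i β
    first i β i<n = trans (count-cong n k (λ w → valid-∷ s c i β w i<n)) (count-guard n k _ _)

  ways-zero : ∀ s c → size n s ≡ 0 → ways 0 s c ≡ 1
  ways-zero s c size≡0
    rewrite count-zero n (valid s c) | isArrangement-[] n s size≡0 | avoidsAll-[] ps = refl

  branch-blocked : ∀ k s c i β → allowed c (suc i , β) ≡ false → branch k s c i β ≡ 0
  branch-blocked k s c i β c↛x rewrite c↛x | ∧-zeroʳ (s i) = refl

  bₙ≡ways : bₙ n 𝒯 ≡ ways n (λ _ → true) nothing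
  bₙ≡ways = cong length (trans (boolFilter-boolFilter (avoidsAll 𝒯) (isSignedPerm n) words)
                               (boolFilter-cong signedPerm-valid words))
    where
    words = wordsOf (alphabet n) n
    signedPerm-valid : ∀ w → isSignedPerm n w ∧ avoidsAll 𝒯 w ≡ valid (λ _ → true) nothing w
    signedPerm-valid w =
      cong₂ (λ p q → p ∧ (q ∧ avoidsAll 𝒯 w)) (isSignedPerm≡isArrangement n w) (sym (all-true w))

mayPrecede : (ℕ → ℕ → Bool) → Letter → Letter → Bool
mayPrecede _≺_ (v , true)  (j , true)  = j ≺ v
mayPrecede _≺_ (v , true)  (j , false) = true
mayPrecede _≺_ (v , false) (j , true)  = false
mayPrecede _≺_ (v , false) (j , false) = j <ᵇ v

mayPrecede-trans : ∀ {_≺_} → (∀ {i j k} → (i ≺ j) ≡ true → (j ≺ k) ≡ true → (i ≺ k) ≡ true) →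
                   ∀ x y z → mayPrecede _≺_ x y ≡ true → mayPrecede _≺_ y z ≡ true →
                   mayPrecede _≺_ x z ≡ true
mayPrecede-trans ≺-trans (v , true)  (m , true)  (j , true)  m≺v j≺m = ≺-trans j≺m m≺v
mayPrecede-trans ≺-trans (v , true)  (m , true)  (j , false) _   _   = refl
mayPrecede-trans ≺-trans (v , true)  (m , false) (j , false) _   _   = refl
mayPrecede-trans ≺-trans (v , false) (m , false) (j , false) m<v j<m = <ᵇ-trans {j} {m} {v} j<m m<v

-- An avoider is a ≺-decreasing run of barred letters followed by a decreasing run of unbarred
-- letters, hence it is determined by its set of barred letters.
module TwoRuns (n : ℕ) (ps : List (Letter × Letter)) (_≺_ : ℕ → ℕ → Bool)
  (≺-irrefl : ∀ v → (v ≺ v) ≡ false)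
  (≺-trans : ∀ {i j k} → (i ≺ j) ≡ true → (j ≺ k) ≡ true → (i ≺ k) ≡ true)
  (pairAvoids≡mayPrecede : ∀ x y → ∣ x ∣ˡ ≢ ∣ y ∣ˡ → pairAvoids (patterns₂ ps) x y ≡ mayPrecede _≺_ x y)
  (geometric : ∀ a → σ n (λ i → if a i then 2 ^ σ n (λ j → ind (a j ∧ (suc j ≺ suc i))) else 0) + 1
                     ≡ 2 ^ σ n (ind ∘ a))
  where

  open Automaton n ps (mayPrecede _≺_) pairAvoids≡mayPrecede (mayPrecede-trans ≺-trans) public

  ways-unbarred≡0 : ∀ k s μ i → size n s ≡ k → i < n → s i ≡ true → μ ≤ suc i →
                    ways k s (just (μ , false)) ≡ 0
  ways-unbarred≡0 zero    s μ i size≡0 i<n i∈s μ≤1+i =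
    ⊥-elim (0≢1+n (trans (sym size≡0) (size-remove n s i i<n i∈s)))
  ways-unbarred≡0 (suc k) s μ i size≡1+k i<n i∈s μ≤1+i =
    trans (ways-suc k s c)
          (σ-zero n (λ j j<n → cong₂ _+_ (unbarred j j<n) (branch-blocked k s c j true refl)))
    where
    c = just (μ , false)
    unbarred : ∀ j → j < n → branch k s c j false ≡ 0
    unbarred j j<n with s j in j∈s | suc j <ᵇ μ in j<μ
    ... | false | _     = refl
    ... | true  | false = refl
    ... | true  | true  =
      ways-unbarred≡0 k (remove s j) (suc j) i (size-remove-suc n s j j<n j∈s size≡1+k) i<n
                      (trans (remove-≢ s j≢i) i∈s) (<⇒≤ j<i)
      where
      j<i : suc j < suc i
      j<i = <-≤-trans (<ᵇ≡true⇒< {suc j} {μ} j<μ) μ≤1+i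
      j≢i : j ≢ i
      j≢i j≡i = <-irrefl (cong suc j≡i) j<i

  ways-unbarred≡1 : ∀ k s μ → size n s ≡ k → (∀ i → i < n → s i ≡ true → suc i < μ) →
                    ways k s (just (μ , false)) ≡ 1
  unbarred-branches : ∀ k s c → size n s ≡ suc k →
                      (∀ i → i < n → s i ≡ true → allowed c (suc i , false) ≡ true) →
                      σ n (λ i → branch k s c i false) ≡ 1

  ways-unbarred≡1 zero    s μ size≡0   _     = ways-zero s (just (μ , false)) size≡0
  ways-unbarred≡1 (suc k) s μ size≡1+k below =
    trans (ways-suc k s c)
          (trans (σ-+ n _ _)
                 (cong₂ _+_ (unbarred-branches k s c size≡1+k (λ i i<n i∈s → <⇒<ᵇ≡true (below i i<n i∈s)))
                            (σ-zero n (λ i _ → branch-blocked k s c i true refl))))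
    where c = just (μ , false)

  -- Only the largest remaining value can start the final decreasing run.
  unbarred-branches k s c size≡1+k c→unbarred with maximum n s size≡1+k
  ... | m , m<n , m∈s , m-max = trans (σ-single n m m<n others) top
    where
    below-m : ∀ i → i < n → remove s m i ≡ true → suc i < suc m
    below-m i i<n i∈s′ with m ≟ i
    ... | yes refl = ⊥-elim (false≢true (trans (sym (remove-≡ s m)) i∈s′))
    ... | no m≢i   = s≤s (≤∧≢⇒< (m-max i i<n (trans (sym (remove-≢ s m≢i)) i∈s′)) (m≢i ∘ sym))
    top : branch k s c m false ≡ 1
    top rewrite m∈s | c→unbarred m m<n m∈s =
      ways-unbarred≡1 k (remove s m) (suc m) (size-remove-suc n s m m<n m∈s size≡1+k) below-m
    others : ∀ i → i < n → i ≢ m → branch k s c i false ≡ 0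
    others i i<n i≢m with s i in i∈s
    ... | false = refl
    ... | true rewrite c→unbarred i i<n i∈s =
      ways-unbarred≡0 k (remove s i) (suc i) m (size-remove-suc n s i i<n i∈s size≡1+k) m<n
                      (trans (remove-≢ s i≢m) m∈s) (s≤s (m-max i i<n i∈s))

  barrable : (ℕ → Bool) → Maybe Letter → ℕ
  barrable s c = σ n (λ i → ind (s i ∧ allowed c (suc i , true)))

  barrable-remove : ∀ s i → barrable (remove s i) (just (suc i , true)) ≡ barrable s (just (suc i , true))
  barrable-remove s i = σ-cong n same
    where
    same : ∀ j → j < n → ind (remove s i j ∧ (suc j ≺ suc i)) ≡ ind (s j ∧ (suc j ≺ suc i))
    same j _ with i ≟ j
    ... | yes refl = cong ind (trans (cong (_∧ (suc i ≺ suc i)) (remove-≡ s i))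
                                     (sym (trans (cong (s i ∧_) (≺-irrefl (suc i))) (∧-zeroʳ (s i)))))
    ... | no i≢j   = cong (λ b → ind (b ∧ (suc j ≺ suc i))) (remove-≢ s i≢j)

  barred-branches : ∀ s c →
    σ n (λ i → if s i ∧ allowed c (suc i , true) then 2 ^ barrable s (just (suc i , true)) else 0) + 1
      ≡ 2 ^ barrable s c
  barred-branches s c = trans (cong (_+ 1) (σ-cong n exponent)) (geometric a)
    where
    a : ℕ → Bool
    a i = s i ∧ allowed c (suc i , true)
    exponent : ∀ i → i < n → (if a i then 2 ^ barrable s (just (suc i , true)) else 0)
                             ≡ (if a i then 2 ^ σ n (λ j → ind (a j ∧ (suc j ≺ suc i))) else 0)
    exponent i _ with a i in aᵢ
    ... | false = refl
    ... | true  = cong (2 ^_) (σ-cong n (λ j _ → cong ind (filtered j)))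
      where
      filtered : ∀ j → s j ∧ (suc j ≺ suc i) ≡ (s j ∧ allowed c (suc j , true)) ∧ (suc j ≺ suc i)
      filtered j with suc j ≺ suc i in j≺i
      ... | false = trans (∧-zeroʳ (s j)) (sym (∧-zeroʳ _))
      ... | true  = sym (trans (cong (λ b → (s j ∧ b) ∧ true) c→j) (∧-identityʳ (s j ∧ true)))
        where
        c→j = allowed-trans c (suc i , true) (suc j , true) (∧-conicalʳ (s i) _ aᵢ) j≺i

  ways-barred : ∀ k s c → (∀ j → allowed c (j , false) ≡ true) → size n s ≡ k →
                ways k s c ≡ 2 ^ barrable s c
  ways-barred zero    s c _ size≡0 =
    trans (ways-zero s c size≡0) (cong (2 ^_) (sym (σ-zero n nothing-left)))
    where
    nothing-left : ∀ i → i < n → ind (s i ∧ allowed c (suc i , true)) ≡ 0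
    nothing-left i i<n = cong (λ b → ind (b ∧ allowed c (suc i , true))) (size≡0⇒∉ n s size≡0 i i<n)
  ways-barred (suc k) s c c→unbarred size≡1+k = begin
    ways (suc k) s c
      ≡⟨ ways-suc k s c ⟩
    σ n (λ i → branch k s c i false + branch k s c i true)
      ≡⟨ σ-+ n _ _ ⟩
    σ n (λ i → branch k s c i false) + σ n (λ i → branch k s c i true)
      ≡⟨ cong₂ _+_ (unbarred-branches k s c size≡1+k (λ i _ _ → c→unbarred (suc i)))
                   (σ-cong n barred-branch) ⟩
    1 + σ n barred-term
      ≡⟨ +-comm 1 _ ⟩
    σ n barred-term + 1
      ≡⟨ barred-branches s c ⟩
    2 ^ barrable s c
      ∎
    where
    open ≡-Reasoning
    barred-term : ℕ → ℕ
    barred-term i = if s i ∧ allowed c (suc i , true) then 2 ^ barrable s (just (suc i , true)) else 0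
    barred-branch : ∀ i → i < n → branch k s c i true ≡ barred-term i
    barred-branch i i<n with s i in i∈s | allowed c (suc i , true)
    ... | false | _     = refl
    ... | true  | false = refl
    ... | true  | true  = trans (ways-barred k (remove s i) (just (suc i , true)) (λ _ → refl)
                                             (size-remove-suc n s i i<n i∈s size≡1+k))
                                (cong (2 ^_) (barrable-remove s i))

  bₙ≡2^n : bₙ n (patterns₂ ps) ≡ 2 ^ n
  bₙ≡2^n = begin
    bₙ n (patterns₂ ps)                  ≡⟨ bₙ≡ways ⟩
    ways n (λ _ → true) nothing          ≡⟨ ways-barred n (λ _ → true) nothing (λ _ → refl) (σ-ones n) ⟩
    2 ^ barrable (λ _ → true) nothing    ≡⟨ cong (2 ^_) (σ-ones n) ⟩
    2 ^ n                                ∎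
    where open ≡-Reasoning

T₄-pairs : List (Letter × Letter)
T₄-pairs = (u 1 , u 2) ∷ (u 1 , b 2) ∷ (u 2 , b 1) ∷ []

pairAvoids-T₄+b1b2 : ∀ x y → ∣ x ∣ˡ ≢ ∣ y ∣ˡ →
  pairAvoids (patterns₂ (T₄-pairs ++ (b 1 , b 2) ∷ [])) x y ≡ mayPrecede _<ᵇ_ x y
pairAvoids-T₄+b1b2 (v , true) (j , true) v≢j
  rewrite <ᵇ-irrefl v | <ᵇ-irrefl j | <ᵇ-flip v≢j with v <ᵇ j
... | true  = refl
... | false = refl
pairAvoids-T₄+b1b2 (v , true) (j , false) v≢j
  rewrite <ᵇ-irrefl v | <ᵇ-flip v≢j with v <ᵇ j
... | true  = refl
... | false = refl
pairAvoids-T₄+b1b2 (v , false) (j , true) v≢j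
  rewrite <ᵇ-irrefl v | <ᵇ-irrefl j | <ᵇ-flip v≢j with v <ᵇ j
... | true  = refl
... | false = refl
pairAvoids-T₄+b1b2 (v , false) (j , false) v≢j
  rewrite <ᵇ-irrefl v | <ᵇ-irrefl j | <ᵇ-flip v≢j with v <ᵇ j
... | true  = refl
... | false = refl

pairAvoids-T₄+b2b1 : ∀ x y → ∣ x ∣ˡ ≢ ∣ y ∣ˡ →
  pairAvoids (patterns₂ (T₄-pairs ++ (b 2 , b 1) ∷ [])) x y ≡ mayPrecede (λ j v → v <ᵇ j) x y
pairAvoids-T₄+b2b1 (v , true) (j , true) v≢j
  rewrite <ᵇ-irrefl v | <ᵇ-irrefl j | <ᵇ-flip v≢j with v <ᵇ j
... | true  = refl
... | false = refl
pairAvoids-T₄+b2b1 (v , true) (j , false) v≢j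
  rewrite <ᵇ-irrefl v | <ᵇ-flip v≢j with v <ᵇ j
... | true  = refl
... | false = refl
pairAvoids-T₄+b2b1 (v , false) (j , true) v≢j
  rewrite <ᵇ-irrefl v | <ᵇ-irrefl j | <ᵇ-flip v≢j with v <ᵇ j
... | true  = refl
... | false = refl
pairAvoids-T₄+b2b1 (v , false) (j , false) v≢j
  rewrite <ᵇ-irrefl v | <ᵇ-irrefl j | <ᵇ-flip v≢j with v <ᵇ j
... | true  = refl
... | false = refl

pairAvoids-T₄+u2u1 : ∀ x y → ∣ x ∣ˡ ≢ ∣ y ∣ˡ →
  pairAvoids (patterns₂ (T₄-pairs ++ (u 2 , u 1) ∷ [])) x y ≡ barred x
pairAvoids-T₄+u2u1 (v , true)  y          _ = refl
pairAvoids-T₄+u2u1 (v , false) (j , true)  v≢j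
  rewrite <ᵇ-irrefl v | <ᵇ-irrefl j | <ᵇ-flip v≢j with v <ᵇ j
... | true  = refl
... | false = refl
pairAvoids-T₄+u2u1 (v , false) (j , false) v≢j
  rewrite <ᵇ-irrefl v | <ᵇ-irrefl j | <ᵇ-flip v≢j with v <ᵇ j
... | true  = refl
... | false = refl

module BarredThenOneUnbarred (n : ℕ) where

  open Automaton n (T₄-pairs ++ (u 2 , u 1) ∷ []) (λ x _ → barred x) pairAvoids-T₄+u2u1
                 (λ x _ _ x→y _ → x→y) public

  ways-after-unbarred≡0 : ∀ k s v → ways (suc k) s (just (v , false)) ≡ 0
  ways-after-unbarred≡0 k s v =
    trans (ways-suc k s c)
          (σ-zero n (λ i _ → cong₂ _+_ (branch-blocked k s c i false refl) (branch-blocked k s c i true refl)))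
    where c = just (v , false)

  ways-unconstrained : ∀ k s c → (∀ y → allowed c y ≡ true) → size n s ≡ suc k →
                       ways (suc k) s c ≡ 2 * suc k !
  ways-after-letter : ∀ k s v → size n s ≡ k →
                      ways k s (just (v , false)) + ways k s (just (v , true)) ≡ 2 * k !

  ways-unconstrained k s c unconstrained size≡1+k = begin
    ways (suc k) s c                                        ≡⟨ ways-suc k s c ⟩
    σ n (λ i → branch k s c i false + branch k s c i true)  ≡⟨ σ-cong n first-letter ⟩
    σ n (λ i → if s i then 2 * k ! else 0)                  ≡⟨ σ-if n s (2 * k !) ⟩
    size n s * (2 * k !)                                    ≡⟨ cong (_* (2 * k !)) size≡1+k ⟩
    suc k * (2 * k !)                                       ≡⟨ *-exchange (suc k) 2 (k !) ⟩
    2 * suc k !                                             ∎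
    where
    open ≡-Reasoning
    first-letter : ∀ i → i < n → branch k s c i false + branch k s c i true ≡ (if s i then 2 * k ! else 0)
    first-letter i i<n with s i in i∈s
    ... | false = refl
    ... | true rewrite unconstrained (suc i , false) | unconstrained (suc i , true) =
      ways-after-letter k (remove s i) (suc i) (size-remove-suc n s i i<n i∈s size≡1+k)

  ways-after-letter zero    s v size≡0   =
    cong₂ _+_ (ways-zero s (just (v , false)) size≡0) (ways-zero s (just (v , true)) size≡0)
  ways-after-letter (suc k) s v size≡1+k =
    cong₂ _+_ (ways-after-unbarred≡0 k s v) (ways-unconstrained k s (just (v , true)) (λ _ → refl) size≡1+k)

bₙ-T₄+b1b2 : ∀ n → bₙ n (patterns₂ (T₄-pairs ++ (b 1 , b 2) ∷ [])) ≡ 2 ^ n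
bₙ-T₄+b1b2 n = TwoRuns.bₙ≡2^n n (T₄-pairs ++ (b 1 , b 2) ∷ []) _<ᵇ_
  <ᵇ-irrefl (λ {i} {j} {k} → <ᵇ-trans {i} {j} {k}) pairAvoids-T₄+b1b2 (geometric-< n)

bₙ-T₄+b2b1 : ∀ n → bₙ n (patterns₂ (T₄-pairs ++ (b 2 , b 1) ∷ [])) ≡ 2 ^ n
bₙ-T₄+b2b1 n = TwoRuns.bₙ≡2^n n (T₄-pairs ++ (b 2 , b 1) ∷ []) (λ j v → v <ᵇ j)
  <ᵇ-irrefl (λ {i} {j} {k} j<i k<j → <ᵇ-trans {k} {j} {i} k<j j<i) pairAvoids-T₄+b2b1 (geometric-> n)

bₙ-T₄+u2u1 : ∀ n → bₙ (suc n) (patterns₂ (T₄-pairs ++ (u 2 , u 1) ∷ [])) ≡ 2 * suc n !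
bₙ-T₄+u2u1 n = trans bₙ≡ways (ways-unconstrained n (λ _ → true) nothing (λ _ → refl) (σ-ones (suc n)))
  where open BarredThenOneUnbarred (suc n)

mainTheorem5 : (n : ℕ) → 1 ≤ n →
    (bₙ n (T₄ ++ ((b 1 ∷ b 2 ∷ []) ∷ [])) ≡ 2 ^ n)
    × (bₙ n (T₄ ++ ((b 2 ∷ b 1 ∷ []) ∷ [])) ≡ 2 ^ n)
    × (bₙ n (T₄ ++ ((u 2 ∷ u 1 ∷ []) ∷ [])) ≡ 2 * (n !))
mainTheorem5 (suc n) _ = bₙ-T₄+b1b2 (suc n) , bₙ-T₄+b2b1 (suc n) , bₙ-T₄+u2u1 n
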